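{- Let $G$ be a connected $P_4$-sparse graph. Then $\sigma_T(G)\le 3$.
   Context: All graphs are finite and simple. A graph is $P_4$-sparse if every set of $5$ vertices induces at most one induced path $P_4$. A tree $t$-spanner of a connected graph $G$ is a spanning tree $T$ of $G$ such that $d_T(u,v)\le t$ for every edge $uv$ of $G$; the stretch index $\sigma_T(G)$ is the smallest $t$ for which $G$ has a tree $t$-spanner. -}

module Defs where

open import Data.Nat using (ℕ; zero; suc; _≤_)
open import Data.Bool using (Bool; true; false)
open import Data.Fin using (Fin)
open import Data.Fin.Subset using (Subset; ∣_∣; _∪_; ⁅_⁆; _⊆_)
open import Data.List using (List; []; _∷_; _++_; [_]; length)
open import Data.List.Relation.Unary.Linked using (Linked)
open import Data.List.Relation.Unary.Unique.Propositional using (Unique)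
open import Data.Product using (Σ; ∃; _×_; _,_)
open import Relation.Binary.PropositionalEquality using (_≡_)

record Graph (n : ℕ) : Set where
  field
    adj   : Fin n → Fin n → Bool
    sym   : ∀ u v → adj u v ≡ adj v u
    irrefl : ∀ u → adj u u ≡ false

open Graph public

Adj : ∀ {n} → Graph n → Fin n → Fin n → Set
Adj G u v = adj G u v ≡ true

data Walk {n : ℕ} (G : Graph n) : Fin n → Fin n → ℕ → Set where
  nil  : ∀ {u} → Walk G u u 0
  cons : ∀ {u v w k} → Adj G u v → Walk G v w k → Walk G u w (suc k)

Connected : ∀ {n} → Graph n → Set
Connected G = ∀ u v → ∃ λ k → Walk G u v k

DistAtMost : ∀ {n} → Graph n → Fin n → Fin n → ℕ → Set
DistAtMost G u v t = ∃ λ k → k ≤ t × Walk G u v k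

HasCycle : ∀ {n} → Graph n → Set
HasCycle {n} G =
  Σ (Fin n) λ u → Σ (List (Fin n)) λ ws →
    2 ≤ length ws × Unique (u ∷ ws) × Linked (Adj G) (u ∷ ws ++ [ u ])

IsTree : ∀ {n} → Graph n → Set
IsTree G = Connected G × (HasCycle G → Data.Empty.⊥)
  where import Data.Empty

SpanningSubgraph : ∀ {n} → Graph n → Graph n → Set
SpanningSubgraph T G = ∀ u v → Adj T u v → Adj G u v

TreeSpanner : ∀ {n} → Graph n → ℕ → Graph n → Set
TreeSpanner G t T =
  SpanningSubgraph T G × IsTree T × (∀ u v → Adj G u v → DistAtMost T u v t)

-- σ_T(G) ≤ t : the least t' for which G has a tree t'-spanner is at most t,
-- i.e. G has a tree t'-spanner for some t' ≤ t.
StretchIndexAtMost : ∀ {n} → Graph n → ℕ → Set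
StretchIndexAtMost {n} G t = ∃ λ t' → t' ≤ t × Σ (Graph n) (TreeSpanner G t')

InducesP4 : ∀ {n} → Graph n → Subset n → Set
InducesP4 {n} G A =
  ∣ A ∣ ≡ 4 ×
  Σ (Fin n) λ a → Σ (Fin n) λ b → Σ (Fin n) λ c → Σ (Fin n) λ d →
    A ≡ ⁅ a ⁆ ∪ ⁅ b ⁆ ∪ ⁅ c ⁆ ∪ ⁅ d ⁆ ×
    adj G a b ≡ true × adj G b c ≡ true × adj G c d ≡ true ×
    adj G a c ≡ false × adj G b d ≡ false × adj G a d ≡ false

P4Sparse : ∀ {n} → Graph n → Set
P4Sparse {n} G =
  ∀ (X A B : Subset n) → ∣ X ∣ ≡ 5 → A ⊆ X → B ⊆ X →
    InducesP4 G A → InducesP4 G B → A ≡ B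

-- Let c be a vertex whose closed neighbourhood N[c] is as large as possible.  If y ~ c
-- and x ~ x′ are two further vertices outside N[c] with y ~ x but y ≁ x′, then x′-x-y-c
-- is an induced P₄; P₄-sparseness forces every other neighbour of c to be adjacent to y,
-- so N[c] ⊊ N[y], contradicting maximality.  Hence a neighbour of c adjacent to one end
-- of an edge outside N[c] is adjacent to the other end.  Consequently every vertex lies
-- within distance 2 of c, and two adjacent vertices at distance 2 have the same
-- neighbours in N(c).  The breadth-first tree rooted at c, in which a vertex at distance
-- 2 hangs from the first of its neighbours in N(c), is therefore a tree 3-spanner: an
-- edge between two vertices at distance 2 joins two siblings, and any other edge is
-- spanned by the path through c, of length at most 1 + 2.
module Submission where

open import Defs hiding (sym)
open import Data.Nat using (ℕ; zero; suc; _+_; _≤_; _<_; z≤n; s≤s)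
open import Data.Nat.Properties using (≤-refl; n≤1+n; m≤n⇒m≤1+n; <-trans; <-irrefl; <-asym; <⇒≱)
open import Data.Bool using (Bool; true; false; not; _∧_; _∨_)
open import Data.Bool.Properties using (∨-comm; ¬-not) renaming (_≟_ to _≟ᵇ_)
open import Data.Fin using (Fin; zero; suc; _≟_)
open import Data.Fin.Subset using (Subset; ∣_∣; _∪_; ⁅_⁆; _⊆_; inside; outside)
  renaming (⊥ to ∅; _∈_ to _∈ₛ_; _∉_ to _∉ₛ_)
open import Data.Fin.Subset.Properties
  using (∉⊥; x∈⁅x⁆; x∈⁅y⁆⇒x≡y; x∈p∪q⁺; x∈p∪q⁻; q⊆p∪q; ∪-identityˡ; ∪-identityʳ; ∣⊥∣≡0; p⊂q⇒∣p∣<∣q∣)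
open import Data.List using (List; []; _∷_; _++_; [_]; length; head; filter; allFin)
open import Data.List.Properties using (filter-≐)
open import Data.List.Extrema.Nat using (argmax; f[xs]≤f[argmax])
open import Data.List.Membership.Propositional using (_∈_; _∉_)
open import Data.List.Membership.Propositional.Properties using (∈-filter⁺; ∈-filter⁻; ∈-allFin)
open import Data.List.Relation.Unary.Any using (here; there)
open import Data.List.Relation.Unary.All as All using (All; []; _∷_)
open import Data.List.Relation.Unary.Linked as Linked using (Linked; [-]; _∷_)
open import Data.List.Relation.Unary.Unique.Propositional using (Unique)
open import Data.List.Relation.Unary.Unique.Propositional.Properties using (Unique[x∷xs]⇒x∉xs)
open import Data.List.Relation.Unary.AllPairs using ([]; _∷_)
open import Data.Maybe using (just; fromMaybe)
open import Data.Vec using (_∷_; here; there; tabulate)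
open import Data.Vec.Properties using (lookup∘tabulate; []=⇒lookup; lookup⇒[]=)
open import Data.Product using (∃; _×_; _,_; proj₁; proj₂)
open import Data.Sum using (_⊎_; inj₁; inj₂)
open import Data.Empty using (⊥; ⊥-elim)
open import Function using (_∘_; flip)
open import Relation.Binary using (Rel; Transitive)
open import Relation.Nullary using (¬_; Dec; yes; no; does)
open import Relation.Nullary.Decidable using (dec-true; _×-dec_)
open import Relation.Unary using (Pred; Decidable)
open import Relation.Binary.PropositionalEquality using (_≡_; _≢_; refl; sym; trans; cong; subst; ≢-sym)

module _ {a} {A : Set a} where

  lastOf : A → List A → A
  lastOf x []       = x
  lastOf _ (y ∷ ys) = lastOf y ys

  lastOf-∈ : ∀ x xs → lastOf x xs ∈ x ∷ xs
  lastOf-∈ x []       = here refl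
  lastOf-∈ _ (y ∷ ys) = there (lastOf-∈ y ys)

  module _ {r} {R : Rel A r} where

    Linked-last : ∀ {x} xs {z} → Linked R (x ∷ xs ++ [ z ]) → R (lastOf x xs) z
    Linked-last []       (xRz ∷ [-]) = xRz
    Linked-last (_ ∷ xs) (_ ∷ l)     = Linked-last xs l

    Linked-first-last : Transitive R → ∀ {x} xs {z} → Linked R (x ∷ xs ++ [ z ]) → R x z
    Linked-first-last _     []       (xRz ∷ [-]) = xRz
    Linked-first-last trans (_ ∷ xs) (xRy ∷ l)   = trans xRy (Linked-first-last trans xs l)

  data Backtrack : List A → Set a where
    turn  : ∀ {x y z zs} → x ≡ z → Backtrack (x ∷ y ∷ z ∷ zs)
    later : ∀ {x xs} → Backtrack xs → Backtrack (x ∷ xs)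

  unique-snoc-¬backtrack : ∀ {z} xs → Unique xs → z ∉ xs → ¬ Backtrack (xs ++ [ z ])
  unique-snoc-¬backtrack []              _          _  (later ())
  unique-snoc-¬backtrack (_ ∷ _ ∷ [])    _          z∉ (turn x≡z) = z∉ (here (sym x≡z))
  unique-snoc-¬backtrack (_ ∷ _ ∷ _ ∷ _) uniq       _  (turn x≡w) = Unique[x∷xs]⇒x∉xs uniq (there (here x≡w))
  unique-snoc-¬backtrack (_ ∷ xs)        (_ ∷ uniq) z∉ (later bt) =
    unique-snoc-¬backtrack xs uniq (z∉ ∘ there) bt

  cycle-¬backtrack : ∀ {u} ws → 2 ≤ length ws → Unique (u ∷ ws) → ¬ Backtrack (u ∷ ws ++ [ u ])
  cycle-¬backtrack (_ ∷ [])    (s≤s ()) _                _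
  cycle-¬backtrack (_ ∷ _ ∷ _) _        uniq             (turn u≡w) = Unique[x∷xs]⇒x∉xs uniq (there (here u≡w))
  cycle-¬backtrack ws          _        uniq@(_ ∷ uniq′) (later bt) =
    unique-snoc-¬backtrack ws uniq′ (Unique[x∷xs]⇒x∉xs uniq) bt

  head-∈ : ∀ {x : A} {xs} → x ∈ xs → ∃ λ y → head xs ≡ just y × y ∈ xs
  head-∈ {xs = y ∷ _} _ = y , refl , here refl

  head-filter : ∀ {p} {P : Pred A p} (P? : Decidable P) {x : A} xs → x ∈ xs → P x →
                ∃ λ y → head (filter P? xs) ≡ just y × P y
  head-filter P? xs x∈xs px =
    let y , eq , y∈ = head-∈ (∈-filter⁺ P? x∈xs px) in y , eq , proj₂ (∈-filter⁻ P? {xs = xs} y∈)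

maximiser : ∀ {m} (f : Fin (suc m) → ℕ) → ∃ λ c → ∀ v → f v ≤ f c
maximiser f = argmax f zero (allFin _) , λ v → All.lookup (f[xs]≤f[argmax] {f = f} zero (allFin _)) (∈-allFin v)

module _ {n} {G : Graph n} where

  Adj-sym : ∀ {u v} → Adj G u v → Adj G v u
  Adj-sym {u} {v} uv = trans (Graph.sym G v u) uv

  _++ʷ_ : ∀ {u v w k l} → Walk G u v k → Walk G v w l → Walk G u w (k + l)
  nil      ++ʷ q = q
  cons e p ++ʷ q = cons e (p ++ʷ q)

  snocʷ : ∀ {u v w k} → Walk G u v k → Adj G v w → Walk G u w (suc k)
  snocʷ nil        e = cons e nil
  snocʷ (cons f p) e = cons f (snocʷ p e)

  reverseʷ : ∀ {u v k} → Walk G u v k → Walk G v u k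
  reverseʷ nil        = nil
  reverseʷ (cons e p) = snocʷ (reverseʷ p) (Adj-sym e)

fromList : ∀ {n} → List (Fin n) → Subset n
fromList []       = ∅
fromList (x ∷ xs) = ⁅ x ⁆ ∪ fromList xs

module _ {n : ℕ} where

  ∈-fromList⁺ : ∀ {x : Fin n} {xs} → x ∈ xs → x ∈ₛ fromList xs
  ∈-fromList⁺ {xs = y ∷ _}  (here refl) = x∈p∪q⁺ (inj₁ (x∈⁅x⁆ y))
  ∈-fromList⁺               (there x∈)  = x∈p∪q⁺ (inj₂ (∈-fromList⁺ x∈))

  ∈-fromList⁻ : ∀ {x : Fin n} xs → x ∈ₛ fromList xs → x ∈ xs
  ∈-fromList⁻ []       x∈ = ⊥-elim (∉⊥ x∈)
  ∈-fromList⁻ (y ∷ xs) x∈ with x∈p∪q⁻ ⁅ y ⁆ (fromList xs) x∈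
  ... | inj₁ x∈⁅y⁆ = here (x∈⁅y⁆⇒x≡y y x∈⁅y⁆)
  ... | inj₂ x∈xs  = there (∈-fromList⁻ xs x∈xs)

  fromList-mono : ∀ {xs ys : List (Fin n)} → All (_∈ ys) xs → fromList xs ⊆ fromList ys
  fromList-mono {xs} xs⊆ys x∈ = ∈-fromList⁺ (All.lookup xs⊆ys (∈-fromList⁻ xs x∈))

∣⁅x⁆∪p∣≡1+∣p∣ : ∀ {n} (x : Fin n) p → x ∉ₛ p → ∣ ⁅ x ⁆ ∪ p ∣ ≡ suc ∣ p ∣
∣⁅x⁆∪p∣≡1+∣p∣ zero    (inside ∷ p)  x∉ = ⊥-elim (x∉ here)
∣⁅x⁆∪p∣≡1+∣p∣ zero    (outside ∷ p) _  = cong (suc ∘ ∣_∣) (∪-identityˡ p)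
∣⁅x⁆∪p∣≡1+∣p∣ (suc x) (inside ∷ p)  x∉ = cong suc (∣⁅x⁆∪p∣≡1+∣p∣ x p (x∉ ∘ there))
∣⁅x⁆∪p∣≡1+∣p∣ (suc x) (outside ∷ p) x∉ = ∣⁅x⁆∪p∣≡1+∣p∣ x p (x∉ ∘ there)

∣fromList∣≡length : ∀ {n} (xs : List (Fin n)) → Unique xs → ∣ fromList xs ∣ ≡ length xs
∣fromList∣≡length {n} []       _                = ∣⊥∣≡0 n
∣fromList∣≡length     (x ∷ xs) uniq@(_ ∷ uniq′) =
  trans (∣⁅x⁆∪p∣≡1+∣p∣ x (fromList xs) (Unique[x∷xs]⇒x∉xs uniq ∘ ∈-fromList⁻ xs))
        (cong suc (∣fromList∣≡length xs uniq′))

closedNeighbourhood : ∀ {n} → Graph n → Fin n → Subset n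
closedNeighbourhood G v = tabulate (adj G v) ∪ ⁅ v ⁆

module ParentGraph {n} (parent : Fin n → Fin n) where

  Child : Fin n → Fin n → Set
  Child u v = parent u ≡ v × u ≢ v

  childᵇ : Fin n → Fin n → Bool
  childᵇ u v = not (does (u ≟ v)) ∧ does (parent u ≟ v)

  childᵇ⇒Child : ∀ {u v} → childᵇ u v ≡ true → Child u v
  childᵇ⇒Child {u} {v} e with u ≟ v | parent u ≟ v
  ... | no u≢v | yes p = p , u≢v

  Child⇒childᵇ : ∀ {u v} → Child u v → childᵇ u v ≡ true
  Child⇒childᵇ {u} {v} (p , u≢v) with u ≟ v | parent u ≟ v
  ... | yes u≡v | _     = ⊥-elim (u≢v u≡v)
  ... | no _    | yes _ = refl
  ... | no _    | no ¬p = ⊥-elim (¬p p)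

  childᵇ-irrefl : ∀ u → childᵇ u u ≡ false
  childᵇ-irrefl u rewrite dec-true (u ≟ u) refl = refl

  graph : Graph n
  graph = record
    { adj    = λ u v → childᵇ u v ∨ childᵇ v u
    ; sym    = λ u v → ∨-comm (childᵇ u v) (childᵇ v u)
    ; irrefl = λ u → cong (λ b → b ∨ b) (childᵇ-irrefl u)
    }

  edge : ∀ {u v} → Child u v → Adj graph u v
  edge {u} {v} uv = cong (_∨ childᵇ v u) (Child⇒childᵇ uv)

  edge⇒Child : ∀ {u v} → Adj graph u v → Child u v ⊎ Child v u
  edge⇒Child {u} {v} e with childᵇ u v in uv
  ... | true  = inj₁ (childᵇ⇒Child uv)
  ... | false = inj₂ (childᵇ⇒Child e)

  module _ (rank : Fin n → ℕ) (rank-parent : ∀ {u v} → Child u v → rank v < rank u) where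

    keeps-descending : ∀ {x y zs} → ¬ Backtrack (x ∷ y ∷ zs) → Linked (Adj graph) (x ∷ y ∷ zs) →
                       Child y x → Linked (flip Child) (x ∷ y ∷ zs)
    keeps-descending {zs = []}    _   _           yx = yx ∷ [-]
    keeps-descending {zs = _ ∷ _} ¬bt (_ ∷ yz∷zs) yx with edge⇒Child (Linked.head yz∷zs)
    ... | inj₁ yz = ⊥-elim (¬bt (turn (trans (sym (proj₁ yx)) (proj₁ yz))))
    ... | inj₂ zy = yx ∷ keeps-descending (¬bt ∘ later) yz∷zs zy

    arrives-from-parent : ∀ x ys {z} → ¬ Backtrack (x ∷ ys ++ [ z ]) →
                          Linked (Adj graph) (x ∷ ys ++ [ z ]) → rank x < rank z → Child z (lastOf x ys)
    arrives-from-parent x [] _ (xz ∷ [-]) x<z with edge⇒Child xz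
    ... | inj₁ x-child = ⊥-elim (<-asym x<z (rank-parent x-child))
    ... | inj₂ z-child = z-child
    arrives-from-parent x (y ∷ ys) ¬bt link@(xy ∷ l) x<z with edge⇒Child xy
    ... | inj₁ x-child = arrives-from-parent y ys (¬bt ∘ later) l (<-trans (rank-parent x-child) x<z)
    ... | inj₂ y-child = Linked-last ys (Linked.tail (keeps-descending ¬bt link y-child))

    acyclic : HasCycle graph → ⊥
    acyclic (_ , _ ∷ [] , s≤s () , _)
    acyclic (u , ws@(w ∷ w₂ ∷ ws′) , len , uniq@(_ ∷ uniq′) , link) =
      first-edge (edge⇒Child (Linked.head link))
      where
      ¬bt : ¬ Backtrack (u ∷ ws ++ [ u ])
      ¬bt = cycle-¬backtrack ws len uniq

      -- Going down first, the ranks would increase all the way round; going up first, the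
      -- parent of u would be both w and the last vertex of the cycle.
      first-edge : Child u w ⊎ Child w u → ⊥
      first-edge (inj₂ w-child) =
        <-irrefl refl (Linked-first-last <-trans ws (Linked.map rank-parent (keeps-descending ¬bt link w-child)))
      first-edge (inj₁ u-child@(u→w , _)) =
        Unique[x∷xs]⇒x∉xs uniq′ (subst (_∈ w₂ ∷ ws′) (trans (sym u→last) u→w) (lastOf-∈ w₂ ws′))
        where
        u→last : parent u ≡ lastOf w (w₂ ∷ ws′)
        u→last = proj₁ (arrives-from-parent w (w₂ ∷ ws′) (¬bt ∘ later) (Linked.tail link) (rank-parent u-child))

module Notation {n} (G : Graph n) where

  infix 4 _~_ _≁_ _~?_

  _~_ : Fin n → Fin n → Set
  _~_ = Adj G

  _≁_ : Fin n → Fin n → Set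
  u ≁ v = ¬ u ~ v

  _~?_ : ∀ u v → Dec (u ~ v)
  u ~? v = adj G u v ≟ᵇ true

  ~-sym : ∀ {u v} → u ~ v → v ~ u
  ~-sym = Adj-sym {G = G}

  ~⇒≢ : ∀ {u v} → u ~ v → u ≢ v
  ~⇒≢ {u} uu refl with trans (sym uu) (Graph.irrefl G u)
  ... | ()

  ~-≁⇒≢ : ∀ {w u v} → w ~ u → w ≁ v → u ≢ v
  ~-≁⇒≢ wu w≁v refl = w≁v wu

  N[_] : Fin n → Subset n
  N[_] = closedNeighbourhood G

  ∈N[]⁺ : ∀ {u v} → v ~ u ⊎ u ≡ v → u ∈ₛ N[ v ]
  ∈N[]⁺ {u} {v} (inj₁ vu)   = x∈p∪q⁺ (inj₁ (lookup⇒[]= u _ (trans (lookup∘tabulate (adj G v) u) vu)))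
  ∈N[]⁺ {v = v} (inj₂ refl) = x∈p∪q⁺ (inj₂ (x∈⁅x⁆ v))

  ∈N[]⁻ : ∀ {u v} → u ∈ₛ N[ v ] → v ~ u ⊎ u ≡ v
  ∈N[]⁻ {u} {v} u∈ with x∈p∪q⁻ (tabulate (adj G v)) ⁅ v ⁆ u∈
  ... | inj₁ u∈nbrs = inj₁ (trans (sym (lookup∘tabulate (adj G v) u)) ([]=⇒lookup u∈nbrs))
  ... | inj₂ u∈⁅v⁆  = inj₂ (x∈⁅y⁆⇒x≡y v u∈⁅v⁆)

module P4 {n} (G : Graph n) (sparse : P4Sparse G) where

  open Notation G

  induces-P4 : ∀ {a b c d} → a ~ b → b ~ c → c ~ d → a ≁ c → b ≁ d → a ≁ d →
               InducesP4 G (fromList (a ∷ b ∷ c ∷ d ∷ []))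
  induces-P4 {a} {b} {c} {d} ab bc cd ac bd ad =
    ∣fromList∣≡length (a ∷ b ∷ c ∷ d ∷ []) distinct , a , b , c , d ,
    cong (λ p → ⁅ a ⁆ ∪ ⁅ b ⁆ ∪ ⁅ c ⁆ ∪ p) (∪-identityʳ ⁅ d ⁆) ,
    ab , bc , cd , ¬-not ac , ¬-not bd , ¬-not ad
    where
    distinct : Unique (a ∷ b ∷ c ∷ d ∷ [])
    distinct = (~⇒≢ ab ∷ ≢-sym (~-≁⇒≢ (~-sym cd) (ad ∘ ~-sym)) ∷ ~-≁⇒≢ (~-sym ab) bd ∷ [])
             ∷ (~⇒≢ bc ∷ ~-≁⇒≢ ab ad ∷ [])
             ∷ (~⇒≢ cd ∷ [])
             ∷ [] ∷ []

  no-second-P4 : ∀ {as bs z} → InducesP4 G (fromList as) → InducesP4 G (fromList bs) →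
                 z ∉ as → All (_∈ z ∷ as) bs → z ∉ bs
  no-second-P4 {as} {bs} {z} P Q z∉as bs⊆ z∈bs =
    z∉as (∈-fromList⁻ as (subst (z ∈ₛ_) (sym P≡Q) (∈-fromList⁺ z∈bs)))
    where
    five : ∣ fromList (z ∷ as) ∣ ≡ 5
    five = trans (∣⁅x⁆∪p∣≡1+∣p∣ z (fromList as) (z∉as ∘ ∈-fromList⁻ as)) (cong suc (proj₁ P))
    P≡Q : fromList as ≡ fromList bs
    P≡Q = sparse (fromList (z ∷ as)) _ _ five (q⊆p∪q ⁅ z ⁆ (fromList as)) (fromList-mono bs⊆) P Q

  end-neighbour-adjacent : ∀ {a b c d z} → a ~ b → b ~ c → c ~ d → a ≁ c → b ≁ d → a ≁ d →
                           d ~ z → z ≢ c → z ~ c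
  end-neighbour-adjacent {a} {b} {c} {d} {z} ab bc cd ac bd ad dz z≢c with z ~? c
  ... | yes zc  = zc
  ... | no z≁c = ⊥-elim (other-P4 (z ~? a) (z ~? b))
    where
    z∉abcd : z ∉ a ∷ b ∷ c ∷ d ∷ []
    z∉abcd (here z≡a)                         = ~-≁⇒≢ dz (ad ∘ ~-sym) z≡a
    z∉abcd (there (here z≡b))                 = ~-≁⇒≢ dz (bd ∘ ~-sym) z≡b
    z∉abcd (there (there (here z≡c)))         = z≢c z≡c
    z∉abcd (there (there (there (here z≡d)))) = ~⇒≢ dz (sym z≡d)

    abcd : InducesP4 G (fromList (a ∷ b ∷ c ∷ d ∷ []))
    abcd = induces-P4 ab bc cd ac bd ad

    ∈z : z ∈ z ∷ a ∷ b ∷ c ∷ d ∷ []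
    ∈z = here refl
    ∈a : a ∈ z ∷ a ∷ b ∷ c ∷ d ∷ []
    ∈a = there (here refl)
    ∈b : b ∈ z ∷ a ∷ b ∷ c ∷ d ∷ []
    ∈b = there (there (here refl))
    ∈c : c ∈ z ∷ a ∷ b ∷ c ∷ d ∷ []
    ∈c = there (there (there (here refl)))
    ∈d : d ∈ z ∷ a ∷ b ∷ c ∷ d ∷ []
    ∈d = there (there (there (there (here refl))))

    -- Depending on z ~ a and z ~ b, one of a-z-d-c, a-b-z-d, z-d-c-b is a second induced P₄.
    other-P4 : Dec (z ~ a) → Dec (z ~ b) → ⊥
    other-P4 (yes za) _ =
      no-second-P4 abcd (induces-P4 (~-sym za) (~-sym dz) (~-sym cd) ad z≁c ac) z∉abcd
        (∈a ∷ ∈z ∷ ∈d ∷ ∈c ∷ []) (there (here refl))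
    other-P4 (no z≁a) (yes zb) =
      no-second-P4 abcd (induces-P4 ab (~-sym zb) (~-sym dz) (z≁a ∘ ~-sym) bd ad) z∉abcd
        (∈a ∷ ∈b ∷ ∈z ∷ ∈d ∷ []) (there (there (here refl)))
    other-P4 (no z≁a) (no z≁b) =
      no-second-P4 abcd (induces-P4 (~-sym dz) (~-sym cd) (~-sym bc) z≁c (bd ∘ ~-sym) z≁b) z∉abcd
        (∈z ∷ ∈d ∷ ∈c ∷ ∈b ∷ []) (here refl)

module BreadthFirstTree {n} (G : Graph n) (connected : Connected G) (sparse : P4Sparse G)
                        (c : Fin n) (c-max : ∀ v → ∣ closedNeighbourhood G v ∣ ≤ ∣ closedNeighbourhood G c ∣) where

  open Notation G
  open P4 G sparse

  absorbs-outer-edge : ∀ {y x x′} → c ~ y → y ~ x → x ~ x′ → c ≁ x → c ≁ x′ → y ~ x′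
  absorbs-outer-edge {y} {x} {x′} cy yx xx′ cx cx′ with y ~? x′
  ... | yes yx′ = yx′
  ... | no y≁x′ = ⊥-elim (<⇒≱ (p⊂q⇒∣p∣<∣q∣ (N[c]⊆N[y] , x , ∈N[]⁺ (inj₁ yx) , x∉N[c])) (c-max y))
    where
    N[c]⊆N[y] : N[ c ] ⊆ N[ y ]
    N[c]⊆N[y] {z} z∈ with ∈N[]⁻ z∈ | z ≟ y
    ... | inj₂ refl | _       = ∈N[]⁺ (inj₁ (~-sym cy))
    ... | inj₁ _    | yes z≡y = ∈N[]⁺ (inj₂ z≡y)
    ... | inj₁ cz   | no z≢y  =
      ∈N[]⁺ (inj₁ (~-sym (end-neighbour-adjacent (~-sym xx′) (~-sym yx) (~-sym cy)
                                                 (y≁x′ ∘ ~-sym) (cx ∘ ~-sym) (cx′ ∘ ~-sym) cz z≢y)))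
    x∉N[c] : x ∉ₛ N[ c ]
    x∉N[c] x∈ with ∈N[]⁻ x∈
    ... | inj₁ cx″ = cx cx″
    ... | inj₂ x≡c = ~-≁⇒≢ (~-sym xx′) (cx′ ∘ ~-sym) x≡c

  data WithinTwo (v : Fin n) : Set where
    centre   : v ≡ c → WithinTwo v
    adjacent : c ~ v → WithinTwo v
    through  : ∀ {y} → c ~ y → y ~ v → WithinTwo v

  within-two-step : ∀ {u v} → WithinTwo u → u ~ v → WithinTwo v
  within-two-step {u} {v} wu uv with c ~? v | c ~? u
  ... | yes cv | _      = adjacent cv
  ... | no _   | yes cu = through cu uv
  ... | no c≁v | no c≁u with wu
  ...   | centre refl   = ⊥-elim (c≁v uv)
  ...   | adjacent cu   = ⊥-elim (c≁u cu)
  ...   | through cy yu = through cy (absorbs-outer-edge cy yu uv c≁u c≁v)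

  within-two-walk : ∀ {u v k} → Walk G u v k → WithinTwo u → WithinTwo v
  within-two-walk nil         wu = wu
  within-two-walk (cons uw p) wu = within-two-walk p (within-two-step wu uw)

  within-two : ∀ v → WithinTwo v
  within-two v = within-two-walk (proj₂ (connected c v)) (centre refl)

  CommonNeighbour : Fin n → Pred (Fin n) _
  CommonNeighbour v y = c ~ y × y ~ v

  common? : ∀ v → Decidable (CommonNeighbour v)
  common? v y = (c ~? y) ×-dec (y ~? v)

  -- The default c is junk: every vertex outside N[c] has a neighbour in N(c) (far-common).
  hub : Fin n → Fin n
  hub v = fromMaybe c (head (filter (common? v) (allFin n)))

  hub-common : ∀ {v y} → CommonNeighbour v y → CommonNeighbour v (hub v)
  hub-common {v} {y} cyv with head-filter (common? v) (allFin n) (∈-allFin y) cyv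
  ... | _ , eq , chv rewrite eq = chv

  hub-agree : ∀ {u v} → u ~ v → c ≁ u → c ≁ v → hub u ≡ hub v
  hub-agree {u} {v} uv cu cv =
    cong (fromMaybe c ∘ head) (filter-≐ (common? u) (common? v) (to , from) (allFin n))
    where
    to : ∀ {y} → CommonNeighbour u y → CommonNeighbour v y
    to (cy , yu) = cy , absorbs-outer-edge cy yu uv cu cv
    from : ∀ {y} → CommonNeighbour v y → CommonNeighbour u y
    from (cy , yv) = cy , absorbs-outer-edge cy yv (~-sym uv) cv cu

  data Layer (v : Fin n) : Set where
    root : v ≡ c → Layer v
    near : c ~ v → Layer v
    far  : v ≢ c → c ≁ v → Layer v

  layer : ∀ v → Layer v
  layer v with v ≟ c | c ~? v
  ... | yes v≡c | _      = root v≡c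
  ... | no _    | yes cv = near cv
  ... | no v≢c  | no c≁v = far v≢c c≁v

  depth : ∀ {v} → Layer v → ℕ
  depth (root _)  = 0
  depth (near _)  = 1
  depth (far _ _) = 2

  parentOf : ∀ {v} → Layer v → Fin n
  parentOf     (root _)  = c
  parentOf     (near _)  = c
  parentOf {v} (far _ _) = hub v

  far-common : ∀ {v} → v ≢ c → c ≁ v → CommonNeighbour v (hub v)
  far-common {v} v≢c c≁v with within-two v
  ... | centre v≡c    = ⊥-elim (v≢c v≡c)
  ... | adjacent cv   = ⊥-elim (c≁v cv)
  ... | through cy yv = hub-common (cy , yv)

  layer-coherent : ∀ {v} (l l′ : Layer v) → parentOf l ≡ parentOf l′ × depth l ≡ depth l′
  layer-coherent (root _)    (root _)    = refl , refl
  layer-coherent (near _)    (near _)    = refl , refl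
  layer-coherent (far _ _)   (far _ _)   = refl , refl
  layer-coherent (root refl) (near cc)   = ⊥-elim (~⇒≢ cc refl)
  layer-coherent (near cc)   (root refl) = ⊥-elim (~⇒≢ cc refl)
  layer-coherent (root v≡c)  (far v≢c _) = ⊥-elim (v≢c v≡c)
  layer-coherent (far v≢c _) (root v≡c)  = ⊥-elim (v≢c v≡c)
  layer-coherent (near cv)   (far _ c≁v) = ⊥-elim (c≁v cv)
  layer-coherent (far _ c≁v) (near cv)   = ⊥-elim (c≁v cv)

  parent : Fin n → Fin n
  parent v = parentOf (layer v)

  rank : Fin n → ℕ
  rank v = depth (layer v)

  open ParentGraph parent using (Child; edge; edge⇒Child)

  T : Graph n
  T = ParentGraph.graph parent

  parent≡ : ∀ {v} (l : Layer v) → parent v ≡ parentOf l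
  parent≡ l = proj₁ (layer-coherent (layer _) l)

  rank≡ : ∀ {v} (l : Layer v) → rank v ≡ depth l
  rank≡ l = proj₂ (layer-coherent (layer _) l)

  depth≤2 : ∀ {v} (l : Layer v) → depth l ≤ 2
  depth≤2 (root _)  = z≤n
  depth≤2 (near _)  = s≤s z≤n
  depth≤2 (far _ _) = ≤-refl

  parent-adjacent : ∀ {v} (l : Layer v) → v ≢ parentOf l → v ~ parentOf l
  parent-adjacent (root v≡c)    v≢c = ⊥-elim (v≢c v≡c)
  parent-adjacent (near cv)     _   = ~-sym cv
  parent-adjacent (far v≢c c≁v) _   = ~-sym (proj₂ (far-common v≢c c≁v))

  parentOf-rank< : ∀ {v} (l : Layer v) → v ≢ parentOf l → rank (parentOf l) < depth l
  parentOf-rank< (root v≡c)    v≢c = ⊥-elim (v≢c v≡c)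
  parentOf-rank< (near _)      _   = subst (_< 1) (sym (rank≡ (root refl))) ≤-refl
  parentOf-rank< (far v≢c c≁v) _   = subst (_< 2) (sym (rank≡ (near (proj₁ (far-common v≢c c≁v))))) ≤-refl

  Child⇒rank< : ∀ {u v} → Child u v → rank v < rank u
  Child⇒rank< {u} (refl , u≢v) = parentOf-rank< (layer u) u≢v

  spanning : SpanningSubgraph T G
  spanning u v e with edge⇒Child {u} {v} e
  ... | inj₁ (refl , u≢v) = parent-adjacent (layer u) u≢v
  ... | inj₂ (refl , v≢u) = ~-sym (parent-adjacent (layer v) v≢u)

  to-parent : ∀ {v} (l : Layer v) → v ≢ parentOf l → Adj T v (parentOf l)
  to-parent l v≢p = edge (parent≡ l , v≢p)

  from-parent : ∀ {v} (l : Layer v) → v ≢ parentOf l → Adj T (parentOf l) v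
  from-parent {v} l v≢p = Adj-sym {G = T} {v} {parentOf l} (to-parent l v≢p)

  far≢hub : ∀ {v} → v ≢ c → c ≁ v → v ≢ hub v
  far≢hub v≢c c≁v = ≢-sym (~⇒≢ (proj₂ (far-common v≢c c≁v)))

  to-centre : ∀ {v} (l : Layer v) → Walk T v c (depth l)
  to-centre (root refl)   = nil
  to-centre (near cv)     = cons (to-parent (near cv) (≢-sym (~⇒≢ cv))) nil
  to-centre (far v≢c c≁v) =
    cons (to-parent (far v≢c c≁v) (far≢hub v≢c c≁v)) (to-centre (near (proj₁ (far-common v≢c c≁v))))

  via-centre : ∀ {u v} (lu : Layer u) (lv : Layer v) → depth lu + depth lv ≤ 3 → DistAtMost T u v 3
  via-centre lu lv le = _ , le , to-centre lu ++ʷ reverseʷ (to-centre lv)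

  via-hub : ∀ {u v} → u ~ v → u ≢ c → c ≁ u → v ≢ c → c ≁ v → Walk T u v 2
  via-hub {u} {v} uv u≢c c≁u v≢c c≁v =
    cons (to-parent (far u≢c c≁u) (far≢hub u≢c c≁u))
         (cons (subst (λ h → Adj T h v) (sym (hub-agree uv c≁u c≁v)) (from-parent (far v≢c c≁v) (far≢hub v≢c c≁v)))
               nil)

  stretch : ∀ u v → u ~ v → DistAtMost T u v 3
  stretch u v uv = by-layers (layer u) (layer v)
    where
    by-layers : Layer u → Layer v → DistAtMost T u v 3
    by-layers lu@(root _)  lv            = via-centre lu lv (m≤n⇒m≤1+n (depth≤2 lv))
    by-layers lu@(near _)  lv            = via-centre lu lv (s≤s (depth≤2 lv))
    by-layers lu@(far _ _) lv@(root _)   = via-centre lu lv (n≤1+n 2)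
    by-layers lu@(far _ _) lv@(near _)   = via-centre lu lv ≤-refl
    by-layers (far u≢c c≁u) (far v≢c c≁v) = 2 , n≤1+n 2 , via-hub uv u≢c c≁u v≢c c≁v

  stretch-index≤3 : StretchIndexAtMost G 3
  stretch-index≤3 =
    3 , ≤-refl , T , spanning ,
    ((λ u v → _ , to-centre (layer u) ++ʷ reverseʷ (to-centre (layer v))) ,
     ParentGraph.acyclic parent rank Child⇒rank<) ,
    stretch

lemma3 : ∀ {n : ℕ} (G : Graph n) → Connected G → P4Sparse G → StretchIndexAtMost G 3
lemma3 {zero}  G connected _ = 3 , ≤-refl , G , (λ _ _ e → e) , (connected , λ { (() , _) }) , λ ()
lemma3 {suc m} G connected sparse =
  BreadthFirstTree.stretch-index≤3 G connected sparse (proj₁ centre) (proj₂ centre)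
  where
  centre : ∃ λ c → ∀ v → ∣ closedNeighbourhood G v ∣ ≤ ∣ closedNeighbourhood G c ∣
  centre = maximiser (∣_∣ ∘ closedNeighbourhood G)
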